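{- Let $k\in\mathbb N$, $i,j\in E_k$ and $b\in\{0,1\}$. Then \[\big\langle (x^i=0)\lor(y^i=1)\lor(z^j=b)\big\rangle_{\mathrm{qpp}}=\big\langle (x^i=y^i)\lor(z^j=b),\ (x^i=0)\lor(y^i=1)\big\rangle_{\mathrm{qpp}}.\]
   Context: $E_k=\{1,\dots,k\}$; superscripts denote sorts. A $k$-sorted relation on $\{0,1\}$ is a subset of $\{0,1\}^n$ with each variable assigned a sort in $E_k$; a displayed disjunction of equations denotes the relation on its variables (with indicated sorts) it defines. $\sigma_\bot$ is the empty $0$-ary relation, $\sigma^i_=$ equality on sort $i$. For a set $S$ of relations, $\langle S\rangle_{\mathrm{qpp}}$ is the set of relations definable by formulas built from predicates in $S\cup\{\sigma_\bot,\sigma_=^1,\dots,\sigma_=^k\}$ using conjunction, existential and universal quantification only, each variable having one sort and substituted only into positions of that sort. -}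

module Defs where

open import Data.Nat using (ℕ; zero; suc)
open import Data.Fin using (Fin; zero; suc)
open import Data.Bool using (Bool; true; false; not; _∨_; _xor_)
open import Data.Product using (Σ; _×_; _,_)
open import Data.Empty using (⊥)
open import Data.Unit using (⊤; tt)
open import Relation.Binary.PropositionalEquality using (_≡_)
open import Function.Bundles using (_⇔_)

-- Sorts E_k = {1,…,k} are represented by Fin k.

-- A k-sorted relation on {0,1}: an arity n, a sort for each of the n
-- variables, and the subset of {0,1}^n (as its characteristic function).
record SRel (k : ℕ) : Set where
  constructor srel
  field
    arity : ℕ
    sorts : Fin arity → Fin k
    rel   : (Fin arity → Bool) → Bool
open SRel public

_▹_ : ∀ {k m} → (Fin m → Fin k) → Fin k → (Fin (suc m) → Fin k)
(Γ ▹ i) zero    = i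
(Γ ▹ i) (suc v) = Γ v

extend : ∀ {m} → (Fin m → Bool) → Bool → (Fin (suc m) → Bool)
extend t b zero    = b
extend t b (suc v) = t v

-- qpp formulas over a set S of relations (given as an indexed family),
-- in a context of m variables with sorts Γ.
data Formula {k : ℕ} {I : Set} (S : I → SRel k) : {m : ℕ} → (Fin m → Fin k) → Set where
  atom : ∀ {m} {Γ : Fin m → Fin k} (ι : I) (f : Fin (arity (S ι)) → Fin m) →
         (∀ p → Γ (f p) ≡ sorts (S ι) p) → Formula S Γ
  bot  : ∀ {m} {Γ : Fin m → Fin k} → Formula S Γ
  eq   : ∀ {m} {Γ : Fin m → Fin k} (i : Fin k) (u v : Fin m) →
         Γ u ≡ i → Γ v ≡ i → Formula S Γ
  and  : ∀ {m} {Γ : Fin m → Fin k} → Formula S Γ → Formula S Γ → Formula S Γ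
  ex   : ∀ {m} {Γ : Fin m → Fin k} (i : Fin k) → Formula S (Γ ▹ i) → Formula S Γ
  all  : ∀ {m} {Γ : Fin m → Fin k} (i : Fin k) → Formula S (Γ ▹ i) → Formula S Γ

⟦_⟧ : ∀ {k I} {S : I → SRel k} {m} {Γ : Fin m → Fin k} →
      Formula S Γ → (Fin m → Bool) → Set
⟦_⟧ {S = S} (atom ι f _) t = rel (S ι) (λ p → t (f p)) ≡ true
⟦ bot ⟧ t        = ⊥
⟦ eq i u v _ _ ⟧ t = t u ≡ t v
⟦ and φ ψ ⟧ t    = ⟦ φ ⟧ t × ⟦ ψ ⟧ t
⟦ ex i φ ⟧ t     = Σ Bool (λ b → ⟦ φ ⟧ (extend t b))
⟦ all i φ ⟧ t    = (b : Bool) → ⟦ φ ⟧ (extend t b)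

InQpp : ∀ {k I} → (I → SRel k) → SRel k → Set
InQpp S R = Σ (Formula S (sorts R)) (λ φ → ∀ t → (rel R t ≡ true) ⇔ ⟦ φ ⟧ t)

SameQpp : ∀ {k I J} → (I → SRel k) → (J → SRel k) → Set
SameQpp S S' = ∀ R → InQpp S R ⇔ InQpp S' R

_==_ : Bool → Bool → Bool
a == b = not (a xor b)

sorts3 : ∀ {k} → Fin k → Fin k → Fin 3 → Fin k
sorts3 i j zero             = i
sorts3 i j (suc zero)       = i
sorts3 i j (suc (suc zero)) = j

sorts2 : ∀ {k} → Fin k → Fin 2 → Fin k
sorts2 i _ = i

-- (x^i = 0) ∨ (y^i = 1) ∨ (z^j = b), variables ordered x, y, z
R-01b : ∀ {k} → Fin k → Fin k → Bool → SRel k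
R-01b i j b = srel 3 (sorts3 i j)
  (λ t → not (t zero) ∨ t (suc zero) ∨ (t (suc (suc zero)) == b))

R-eqb : ∀ {k} → Fin k → Fin k → Bool → SRel k
R-eqb i j b = srel 3 (sorts3 i j)
  (λ t → (t zero == t (suc zero)) ∨ (t (suc (suc zero)) == b))

R-01 : ∀ {k} → Fin k → SRel k
R-01 i = srel 2 (sorts2 i) (λ t → not (t zero) ∨ t (suc zero))

S-left : ∀ {k} → Fin k → Fin k → Bool → ⊤ → SRel k
S-left i j b _ = R-01b i j b

S-right : ∀ {k} → Fin k → Fin k → Bool → Bool → SRel k
S-right i j b true  = R-eqb i j b
S-right i j b false = R-01 i

{-# OPTIONS --safe #-}
-- ⟨·⟩_qpp is a closure operator: replacing every atom of a formula over S by a defining formula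
-- over S' (renamed into place) preserves its meaning, so the two sides agree as soon as each
-- generator is definable from the other set.  Writing R for (x = 0 ∨ y = 1 ∨ z = b):
--   R(x, y, z)  ⟺  ∃u. (u = y ∨ z = b) ∧ (x = 0 ∨ u = 1),
--   (x = y ∨ z = b)  ⟺  R(x, y, z) ∧ R(y, x, z),
--   (x = 0 ∨ y = 1)  ⟺  ∀z. R(x, y, z),  since z ranges over both values and so z = b can fail.
module Submission where

open import Defs
open import Data.Nat using (ℕ)
open import Data.Fin using (Fin; zero; suc; #_; lift)
open import Data.Fin.Properties using (∀-cons)
open import Data.Vec.Functional using ([]; _∷_)
open import Data.Bool using (Bool; true; false; not; _∨_)
open import Data.Bool.Properties using (∨-zeroʳ)
open import Data.Product using (∃-syntax; _×_; _,_; proj₁; proj₂; uncurry)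
open import Data.Product.Function.NonDependent.Propositional using (_×-⇔_)
open import Data.Product.Function.Dependent.Propositional using (Σ-⇔)
open import Data.Unit using (tt)
open import Data.Empty using (⊥)
open import Function using (_∘_)
open import Function.Bundles using (_⇔_; mk⇔; Equivalence)
open import Function.Construct.Identity using (↠-id; ⇔-id)
open import Function.Construct.Symmetry using (⇔-sym)
open import Function.Construct.Composition using (_⇔-∘_)
open import Relation.Binary.PropositionalEquality using (_≡_; _≗_; refl; sym; trans)

Π-⇔ : {A : Set} {B C : A → Set} → (∀ {a} → B a ⇔ C a) → ((a : A) → B a) ⇔ ((a : A) → C a)
Π-⇔ B⇔C = mk⇔ (λ f a → Equivalence.to B⇔C (f a)) (λ g a → Equivalence.from B⇔C (g a))

-- Without function extensionality, rel R need not respect pointwise equality of valuations.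
Extensional : ∀ {k I} → (I → SRel k) → Set
Extensional S = ∀ ι {t t'} → t ≗ t' → rel (S ι) t ≡ rel (S ι) t'

module Renaming {k : ℕ} {I : Set} (S : I → SRel k) where

  private variable
    m n : ℕ
    Γ : Fin m → Fin k
    Δ : Fin n → Fin k

  ▹-lift : ∀ {ρ : Fin n → Fin m} {i} → Γ ∘ ρ ≗ Δ → (Γ ▹ i) ∘ lift 1 ρ ≗ Δ ▹ i
  ▹-lift e zero    = refl
  ▹-lift e (suc v) = e v

  extend-lift : ∀ {ρ : Fin n → Fin m} {t s b} → t ∘ ρ ≗ s → extend t b ∘ lift 1 ρ ≗ extend s b
  extend-lift h zero    = refl
  extend-lift h (suc v) = h v

  rename : (ρ : Fin n → Fin m) → Γ ∘ ρ ≗ Δ → Formula S Δ → Formula S Γ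
  rename ρ e (atom ι f p)   = atom ι (ρ ∘ f) (λ q → trans (e (f q)) (p q))
  rename ρ e bot            = bot
  rename ρ e (eq i u v p q) = eq i (ρ u) (ρ v) (trans (e u) p) (trans (e v) q)
  rename ρ e (and φ ψ)      = and (rename ρ e φ) (rename ρ e ψ)
  rename ρ e (ex i φ)       = ex i (rename (lift 1 ρ) (▹-lift e) φ)
  rename ρ e (all i φ)      = all i (rename (lift 1 ρ) (▹-lift e) φ)

  ⟦rename⟧ : Extensional S → {Γ : Fin m → Fin k} {ρ : Fin n → Fin m}
             (e : Γ ∘ ρ ≗ Δ) (φ : Formula S Δ) → ∀ {t s} → t ∘ ρ ≗ s → ⟦ rename {Γ = Γ} ρ e φ ⟧ t ⇔ ⟦ φ ⟧ s
  ⟦rename⟧ ext e (atom ι f p) h =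
    let t∘ρ∘f≡s∘f = ext ι (h ∘ f) in mk⇔ (trans (sym t∘ρ∘f≡s∘f)) (trans t∘ρ∘f≡s∘f)
  ⟦rename⟧ ext e bot            h = ⇔-id ⊥
  ⟦rename⟧ ext e (eq i u v p q) h =
    mk⇔ (λ tu≡tv → trans (sym (h u)) (trans tu≡tv (h v)))
        (λ su≡sv → trans (h u) (trans su≡sv (sym (h v))))
  ⟦rename⟧ ext e (and φ ψ)      h = ⟦rename⟧ ext e φ h ×-⇔ ⟦rename⟧ ext e ψ h
  ⟦rename⟧ ext e (ex i φ)       h =
    Σ-⇔ (↠-id Bool) (⟦rename⟧ ext (▹-lift e) φ (extend-lift h))
  ⟦rename⟧ ext e (all i φ)      h =
    Π-⇔ (⟦rename⟧ ext (▹-lift e) φ (extend-lift h))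

module Expansion {k : ℕ} {I J : Set} {S : I → SRel k} {S' : J → SRel k}
                 (ext : Extensional S') (defs : ∀ ι → InQpp S' (S ι)) where
  open Renaming S'

  private variable
    m : ℕ
    Γ : Fin m → Fin k

  expand : Formula S Γ → Formula S' Γ
  expand (atom ι f p)   = rename f p (proj₁ (defs ι))
  expand bot            = bot
  expand (eq i u v p q) = eq i u v p q
  expand (and φ ψ)      = and (expand φ) (expand ψ)
  expand (ex i φ)       = ex i (expand φ)
  expand (all i φ)      = all i (expand φ)

  ⟦expand⟧ : (φ : Formula S Γ) → ∀ t → ⟦ expand φ ⟧ t ⇔ ⟦ φ ⟧ t
  ⟦expand⟧ (atom ι f p) t =
    ⇔-sym (proj₂ (defs ι) (t ∘ f)) ⇔-∘ ⟦rename⟧ ext p (proj₁ (defs ι)) (λ _ → refl)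
  ⟦expand⟧ bot            t = ⇔-id ⊥
  ⟦expand⟧ (eq i u v p q) t = ⇔-id (t u ≡ t v)
  ⟦expand⟧ (and φ ψ)      t = ⟦expand⟧ φ t ×-⇔ ⟦expand⟧ ψ t
  ⟦expand⟧ (ex i φ)       t = Σ-⇔ (↠-id Bool) (⟦expand⟧ φ _)
  ⟦expand⟧ (all i φ)      t = Π-⇔ (⟦expand⟧ φ _)

  InQpp-trans : ∀ R → InQpp S R → InQpp S' R
  InQpp-trans R (φ , φ-defines-R) = expand φ , λ t → ⇔-sym (⟦expand⟧ φ t) ⇔-∘ φ-defines-R t

SameQpp-intro : ∀ {k I J} {S : I → SRel k} {S' : J → SRel k} →
                Extensional S → Extensional S' →
                (∀ ι → InQpp S' (S ι)) → (∀ ι → InQpp S (S' ι)) → SameQpp S S'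
SameQpp-intro ext ext' defs defs' R =
  mk⇔ (Expansion.InQpp-trans ext' defs R) (Expansion.InQpp-trans ext defs' R)

implication∨c⇔∃interpolant : ∀ x y c →
  (not x ∨ y ∨ c) ≡ true ⇔ (∃[ u ] ((u == y) ∨ c) ≡ true × (not x ∨ u) ≡ true)
implication∨c⇔∃interpolant x y c =
  mk⇔ (λ h → y ∨ c , interpolates x y c h) (uncurry (eliminate x y c))
  where
  interpolates : ∀ x y c → (not x ∨ y ∨ c) ≡ true →
                 (((y ∨ c) == y) ∨ c) ≡ true × (not x ∨ y ∨ c) ≡ true
  interpolates x y     true  h = ∨-zeroʳ _ , h
  interpolates x true  false h = refl , h
  interpolates x false false h = refl , h
  eliminate : ∀ x y c u → ((u == y) ∨ c) ≡ true × (not x ∨ u) ≡ true → (not x ∨ y ∨ c) ≡ true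
  eliminate false y     c     u     _  = refl
  eliminate true  true  c     u     _  = refl
  eliminate true  false true  u     _  = refl
  eliminate true  false false false (_ , ())
  eliminate true  false false true  (() , _)

==∨c⇔implications∨c : ∀ x y c →
  ((x == y) ∨ c) ≡ true ⇔ ((not x ∨ y ∨ c) ≡ true × (not y ∨ x ∨ c) ≡ true)
==∨c⇔implications∨c true  true  c     = mk⇔ (λ _ → refl , refl) (λ _ → refl)
==∨c⇔implications∨c false false c     = mk⇔ (λ _ → refl , refl) (λ _ → refl)
==∨c⇔implications∨c true  false true  = mk⇔ (λ _ → refl , refl) (λ _ → refl)
==∨c⇔implications∨c false true  true  = mk⇔ (λ _ → refl , refl) (λ _ → refl)
==∨c⇔implications∨c true  false false = mk⇔ (λ ()) (λ ())
==∨c⇔implications∨c false true  false = mk⇔ (λ ()) (λ ())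

implication⇔∀z-implication∨z==b : ∀ x y b →
  (not x ∨ y) ≡ true ⇔ (∀ z → (not x ∨ y ∨ (z == b)) ≡ true)
implication⇔∀z-implication∨z==b false y     b     = mk⇔ (λ _ _ → refl) (λ _ → refl)
implication⇔∀z-implication∨z==b true  true  b     = mk⇔ (λ _ _ → refl) (λ _ → refl)
implication⇔∀z-implication∨z==b true  false true  = mk⇔ (λ ()) (λ h → h false)
implication⇔∀z-implication∨z==b true  false false = mk⇔ (λ ()) (λ h → h true)

module _ {k : ℕ} (i j : Fin k) (b : Bool) where

  extensional-left : Extensional (S-left i j b)
  extensional-left _ t≗t' rewrite t≗t' zero | t≗t' (suc zero) | t≗t' (suc (suc zero)) = refl

  extensional-right : Extensional (S-right i j b)
  extensional-right true  t≗t' rewrite t≗t' zero | t≗t' (suc zero) | t≗t' (suc (suc zero)) = refl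
  extensional-right false t≗t' rewrite t≗t' zero | t≗t' (suc zero) = refl

  -- The variables x, y, z are # 0, # 1, # 2; under a quantifier the bound variable becomes # 0
  -- and they move up by one.
  left-in-right : ∀ ι → InQpp (S-right i j b) (S-left i j b ι)
  left-in-right tt =
    ex i (and (atom true  (# 0 ∷ # 2 ∷ # 3 ∷ []) (∀-cons refl (∀-cons refl (∀-cons refl λ ()))))
              (atom false (# 1 ∷ # 0 ∷ [])       (∀-cons refl (∀-cons refl λ ())))) ,
    λ t → implication∨c⇔∃interpolant (t zero) (t (suc zero)) (t (suc (suc zero)) == b)

  right-in-left : ∀ ι → InQpp (S-left i j b) (S-right i j b ι)
  right-in-left true =
    and (atom tt (# 0 ∷ # 1 ∷ # 2 ∷ []) (∀-cons refl (∀-cons refl (∀-cons refl λ ()))))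
        (atom tt (# 1 ∷ # 0 ∷ # 2 ∷ []) (∀-cons refl (∀-cons refl (∀-cons refl λ ())))) ,
    λ t → ==∨c⇔implications∨c (t zero) (t (suc zero)) (t (suc (suc zero)) == b)
  right-in-left false =
    all j (atom tt (# 1 ∷ # 2 ∷ # 0 ∷ []) (∀-cons refl (∀-cons refl (∀-cons refl λ ())))) ,
    λ t → implication⇔∀z-implication∨z==b (t zero) (t (suc zero)) b

lemma3p10 : (k : ℕ) (i j : Fin k) (b : Bool) →
    SameQpp (S-left i j b) (S-right i j b)
lemma3p10 k i j b =
  SameQpp-intro (extensional-left i j b) (extensional-right i j b)
                (left-in-right i j b) (right-in-left i j b)
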